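{- The set $X=\eta(S)$ equals the set of Cayley permutations that avoid the three mesh patterns $\mathfrak a$, $\mathfrak c$ and $\mathfrak d$. Consequently, for every $n$ the number of Cayley permutations of length $n$ avoiding $\mathfrak a,\mathfrak c,\mathfrak d$ equals $n!$ (i.e., $\{\mathfrak a,\mathfrak c,\mathfrak d\}$ is Wilf-equivalent over Cayley permutations to the pattern $11$).
   Context: A Cayley permutation of length $n\ge0$ is a word $x=x(1)\cdots x(n)$ of positive integers in which every integer from $1$ to $\max(x)$ occurs; $S$ is the set of permutations (one-line notation), $\mathrm{id}_n=12\cdots n$. For a weakly increasing Cayley permutation $u$ and a Cayley permutation $v$ of the same length, the Burge transpose $(u,v)^T$ of the biword with columns $\binom{u(i)}{v(i)}$ is obtained by flipping each column and sorting the columns increasingly by top entry, ties broken by decreasing bottom entry; write $(u,v)^T=(\mathrm{sort}(v),\Gamma(u,v))$. For $\pi\in S_n$ and $i\in[n]$ let $J(i)=0$ if $\pi(i)=1$ and otherwise let $J(i)$ be the index with $\pi(J(i))=\pi(i)-1$. The sites of $\pi$ are $0,1,\dots,n$ (site $0$ is before $\pi(1)$, site $i\ge1$ immediately after $\pi(i)$). Site $0$ is $\eta$-active; site $i\ge1$ is $\eta$-active iff $J(i)<i$ or ($i<n$ and $\pi(i)<\pi(i+1)$). Let $\tilde\upsilon(\pi)(j)$ be the number of $\eta$-active sites among $0,\dots,j-1$, define $\eta(\pi)=\Gamma(\tilde\upsilon(\pi),\pi)$ and $X=\eta(S)$. Mesh patterns (occurrences in a Cayley permutation $x$ of length $n$):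 $x$ contains $\mathfrak a$ if there are indices $i<j<n$ with $x(j)<x(i)=x(j+1)$. $x$ contains $\mathfrak c$ if there are indices $i<j<n$ with $x(j+1)<x(i)<x(j)$ such that no position $p<j$ with $p\ne i$ has $x(j+1)\le x(p)<x(i)$, and no position $p>j+1$ has $x(j+1)<x(p)\le x(i)$. $x$ contains $\mathfrak d$ if there is an index $i<n$ with $x(i)>x(i+1)$ such that no position $p<i$ has $x(i+1)\le x(p)<x(i)$ and no position $p>i+1$ has $x(i+1)<x(p)\le x(i)$. $x$ avoids a pattern if it does not contain it. -}

module Defs where

open import Data.Nat.Base using (ℕ; zero; suc; _+_; _∸_; _⊔_; _≤_; _<_; _≡ᵇ_; _<ᵇ_; _≤ᵇ_)
open import Data.Bool.Base using (Bool; true; false; if_then_else_; _∨_; _∧_)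
open import Data.List.Base using (List; []; _∷_; length; map; foldr; upTo; zip)
open import Data.Nat.ListAction using (sum)
open import Data.List.Relation.Unary.All using (All)
open import Data.List.Membership.Propositional using (_∈_)
open import Data.List.Relation.Unary.Unique.Propositional using (Unique)
open import Data.Product.Base using (_×_; _,_; proj₂; ∃)
open import Relation.Binary.PropositionalEquality using (_≡_; _≢_)
open import Relation.Nullary.Negation.Core using (¬_)

-- Words are lists of naturals.  Positions are 1-indexed: at x i = x(i)
-- for 1 ≤ i ≤ length x (and 0 outside that range, never used there).
at : List ℕ → ℕ → ℕ
at []       _             = 0
at (a ∷ as) zero          = 0
at (a ∷ as) (suc zero)    = a
at (a ∷ as) (suc (suc k)) = at as (suc k)

maxW : List ℕ → ℕ
maxW = foldr _⊔_ 0

IsCayley : List ℕ → Set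
IsCayley x = All (λ a → 1 ≤ a) x × (∀ k → 1 ≤ k → k ≤ maxW x → k ∈ x)

IsPerm : List ℕ → Set
IsPerm x = IsCayley x × Unique x

-- Burge transpose.  Columns (top, bottom); after flipping, column i is
-- (v(i), u(i)).  Sort increasingly by top, ties by decreasing bottom.

colLeq : ℕ × ℕ → ℕ × ℕ → Bool
colLeq (a , b) (c , d) = (a <ᵇ c) ∨ ((a ≡ᵇ c) ∧ (d ≤ᵇ b))

insertCol : ℕ × ℕ → List (ℕ × ℕ) → List (ℕ × ℕ)
insertCol p []       = p ∷ []
insertCol p (q ∷ qs) = if colLeq p q then p ∷ q ∷ qs else q ∷ insertCol p qs

sortCols : List (ℕ × ℕ) → List (ℕ × ℕ)
sortCols = foldr insertCol []

-- (u , v)^T = (sort v , Γ u v)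
Γ : List ℕ → List ℕ → List ℕ
Γ u v = map proj₂ (sortCols (zip v u))

indexOf : List ℕ → ℕ → ℕ
indexOf []       v = 0
indexOf (a ∷ as) v =
  if a ≡ᵇ v then 1 else (if indexOf as v ≡ᵇ 0 then 0 else suc (indexOf as v))

J : List ℕ → ℕ → ℕ
J π i = if at π i ≡ᵇ 1 then 0 else indexOf π (at π i ∸ 1)

active : List ℕ → ℕ → Bool
active π zero    = true
active π (suc i) =
  (J π (suc i) <ᵇ suc i) ∨ ((suc i <ᵇ length π) ∧ (at π (suc i) <ᵇ at π (suc (suc i))))

activeBelow : List ℕ → ℕ → ℕ
activeBelow π j = sum (map (λ s → if active π s then 1 else 0) (upTo j))

υ̃ : List ℕ → List ℕ
υ̃ π = map (λ k → activeBelow π (suc k)) (upTo (length π))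

η : List ℕ → List ℕ
η π = Γ (υ̃ π) π

InX : List ℕ → Set
InX x = ∃ λ π → IsPerm π × η π ≡ x

Contains𝔞 : List ℕ → Set
Contains𝔞 x = ∃ λ i → ∃ λ j →
  1 ≤ i × i < j × j < length x × at x j < at x i × at x i ≡ at x (suc j)

Contains𝔠 : List ℕ → Set
Contains𝔠 x = ∃ λ i → ∃ λ j →
  1 ≤ i × i < j × j < length x ×
  at x (suc j) < at x i × at x i < at x j ×
  (∀ p → 1 ≤ p → p < j → p ≢ i → ¬ (at x (suc j) ≤ at x p × at x p < at x i)) ×
  (∀ p → suc j < p → p ≤ length x → ¬ (at x (suc j) < at x p × at x p ≤ at x i))

Contains𝔡 : List ℕ → Set
Contains𝔡 x = ∃ λ i →
  1 ≤ i × i < length x × at x (suc i) < at x i ×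
  (∀ p → 1 ≤ p → p < i → ¬ (at x (suc i) ≤ at x p × at x p < at x i)) ×
  (∀ p → suc i < p → p ≤ length x → ¬ (at x (suc i) < at x p × at x p ≤ at x i))

Avoids𝔞𝔠𝔡 : List ℕ → Set
Avoids𝔞𝔠𝔡 x = ¬ Contains𝔞 x × ¬ Contains𝔠 x × ¬ Contains𝔡 x

-- For a permutation π let A(s) be the number of active sites among 0, …, s − 1.  Sorting the
-- columns of the Burge transpose shows η(π)(π(s)) = A(s).  A starts at 1 and grows by at most
-- one per site, so η(π) is a Cayley permutation, and π descends across every inactive site;
-- these two facts are what rule out 𝔞, 𝔠 and 𝔡.  Conversely, for a Cayley permutation x
-- avoiding the three patterns let π read the positions of x by increasing value, right to left
-- among equal values.  Along π the values of x stay level or rise by exactly one; avoiding 𝔞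
-- makes the sites where they stay level inactive and avoiding 𝔠 and 𝔡 makes the sites where
-- they rise active, so η(π) = x.  As π is recovered from η(π) as this reading, η is injective
-- and the avoiders of length n are counted by the n! permutations.

module Submission where

open import Defs
open import Data.Bool.Base using (true; false; if_then_else_; T)
open import Data.Bool.Properties using (T-∨; T-∧)
open import Data.Empty using (⊥; ⊥-elim)
open import Data.List.Base
  using (List; []; _∷_; length; map; zip; applyUpTo; upTo; _++_; concatMap)
open import Data.List.Properties
  using (length-map; length-applyUpTo; upTo-∷ʳ; map-++; length-++; map-∘; ∷-injectiveʳ)
open import Data.List.Membership.Propositional using (_∈_; _∉_; find; lose)
open import Data.List.Membership.Propositional.Properties
  using (∈-map⁺; ∈-map⁻; ∈-applyUpTo⁺; ∈-applyUpTo⁻; ∈-concatMap⁺; ∈-concatMap⁻)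
open import Data.List.Relation.Binary.Subset.Propositional using (_⊆_)
open import Data.List.Relation.Binary.Permutation.Propositional
  using (_↭_; refl; prep; swap; trans; ↭-sym; ↭⇒↭ₛ)
open import Data.List.Relation.Binary.Permutation.Propositional.Properties using (∈-resp-↭; All-resp-↭)
import Data.List.Relation.Binary.Permutation.Setoid.Properties as Permutationₛ
open import Data.List.Relation.Unary.All as All using (All; []; _∷_)
open import Data.List.Relation.Unary.AllPairs as AllPairs using (AllPairs; []; _∷_)
import Data.List.Relation.Unary.AllPairs.Properties as AllPairsₚ
import Data.List.Relation.Unary.All.Properties as Allₚ
open import Data.List.Relation.Unary.Any using (here; there)
open import Data.List.Relation.Unary.Unique.Propositional using (Unique)
import Data.List.Relation.Unary.Unique.Propositional.Properties as Uniqueₚ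
open import Data.Nat.Base
open import Data.Nat.Properties
open import Data.Nat.ListAction using (sum)
open import Data.Nat.ListAction.Properties using (sum-++)
open import Data.Product.Base using (_×_; _,_; proj₁; proj₂; ∃)
open import Data.Sum.Base using (_⊎_; inj₁; inj₂; [_,_]; map₂)
open import Data.Unit using (tt)
open import Function.Base using (_∘_; id)
open import Function.Bundles using (_⇔_; mk⇔; Equivalence)
open import Relation.Binary.Definitions using (Tri; tri<; tri≈; tri>)
open import Relation.Binary.PropositionalEquality
  using (_≡_; _≢_; refl; sym; cong; cong₂; subst; subst₂; setoid; module ≡-Reasoning)
  renaming (trans to ≡-trans)
open import Relation.Nullary using (¬_; yes; no)

-- Positions in words

at-∈ : ∀ xs s → 1 ≤ s → s ≤ length xs → at xs s ∈ xs
at-∈ (a ∷ as) (suc zero)    _ _         = here refl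
at-∈ (a ∷ as) (suc (suc s)) _ (s≤s s≤) = there (at-∈ as (suc s) z<s s≤)

∈⇒at : ∀ {xs z} → z ∈ xs → ∃ λ s → 1 ≤ s × s ≤ length xs × at xs s ≡ z
∈⇒at {a ∷ as} (here refl) = 1 , z<s , s≤s z≤n , refl
∈⇒at {a ∷ as} (there z∈)  with ∈⇒at z∈
... | suc s , _ , s≤ , eq = suc (suc s) , z<s , s≤s s≤ , eq

All-at : ∀ {P : ℕ → Set} xs s → All P xs → 1 ≤ s → s ≤ length xs → P (at xs s)
All-at xs s all 1≤s s≤ = All.lookup all (at-∈ xs s 1≤s s≤)

at-injective : ∀ xs s t → Unique xs → 1 ≤ s → s ≤ length xs → 1 ≤ t → t ≤ length xs →
               at xs s ≡ at xs t → s ≡ t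
at-injective (a ∷ as) (suc zero) (suc zero) _ _ _ _ _ _ = refl
at-injective (a ∷ as) (suc zero) (suc (suc t)) (a∉ ∷ _) _ _ _ (s≤s t≤) eq =
  ⊥-elim (All-at as (suc t) a∉ z<s t≤ eq)
at-injective (a ∷ as) (suc (suc s)) (suc zero) (a∉ ∷ _) _ (s≤s s≤) _ _ eq =
  ⊥-elim (All-at as (suc s) a∉ z<s s≤ (sym eq))
at-injective (a ∷ as) (suc (suc s)) (suc (suc t)) (_ ∷ u) _ (s≤s s≤) _ (s≤s t≤) eq =
  cong suc (at-injective as (suc s) (suc t) u z<s s≤ z<s t≤ eq)

at-map : ∀ (f : ℕ → ℕ) xs s → 1 ≤ s → s ≤ length xs → at (map f xs) s ≡ f (at xs s)
at-map f (a ∷ as) (suc zero)    _ _         = refl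
at-map f (a ∷ as) (suc (suc s)) _ (s≤s s≤) = at-map f as (suc s) z<s s≤

at-applyUpTo : ∀ (f : ℕ → ℕ) n k → k < n → at (applyUpTo f n) (suc k) ≡ f k
at-applyUpTo f (suc n) zero    _         = refl
at-applyUpTo f (suc n) (suc k) (s<s k<) = at-applyUpTo (f ∘ suc) n k k<

at-extensionality : ∀ xs ys → length xs ≡ length ys →
                    (∀ s → 1 ≤ s → s ≤ length xs → at xs s ≡ at ys s) → xs ≡ ys
at-extensionality []       []       _   _  = refl
at-extensionality (a ∷ as) (b ∷ bs) len eq =
  cong₂ _∷_ (eq 1 z<s (s≤s z≤n))
    (at-extensionality as bs (suc-injective len) λ { (suc s) _ s≤ → eq (suc (suc s)) z<s (s≤s s≤) })

AllPairs-at : ∀ {R : ℕ → ℕ → Set} xs s t → AllPairs R xs →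
              1 ≤ s → s < t → t ≤ length xs → R (at xs s) (at xs t)
AllPairs-at (a ∷ as) (suc zero) (suc zero) _ _ (s≤s ()) _
AllPairs-at (a ∷ as) (suc zero) (suc (suc t)) (a~ ∷ _) _ _ (s≤s t≤) = All-at as (suc t) a~ z<s t≤
AllPairs-at (a ∷ as) (suc (suc s)) (suc (suc t)) (_ ∷ as~) _ (s<s s<t) (s≤s t≤) =
  AllPairs-at as (suc s) (suc t) as~ z<s s<t t≤

at⇒AllPairs : ∀ {R : ℕ → ℕ → Set} xs →
              (∀ s t → 1 ≤ s → s < t → t ≤ length xs → R (at xs s) (at xs t)) → AllPairs R xs
at⇒AllPairs []       _ = []
at⇒AllPairs {R} (a ∷ as) R-at =
  All.tabulate head ∷ at⇒AllPairs as λ { (suc s) (suc t) _ (s<s s<t) t≤ →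
                                          R-at (suc (suc s)) (suc (suc t)) z<s (s<s (s<s s<t)) (s≤s t≤) }
  where
  head : ∀ {z} → z ∈ as → R a z
  head z∈ with ∈⇒at z∈
  ... | suc t , _ , t≤ , refl = R-at 1 (suc (suc t)) z<s (s<s z<s) (s≤s t≤)

indexOf-at : ∀ xs z → z ∈ xs → 1 ≤ indexOf xs z × indexOf xs z ≤ length xs × at xs (indexOf xs z) ≡ z
indexOf-at (a ∷ as) z z∈ with a ≡ᵇ z in a≡ᵇz
... | true  = z<s , s≤s z≤n , ≡ᵇ⇒≡ a z (subst T (sym a≡ᵇz) tt)
... | false with z∈
...   | here refl = ⊥-elim (subst T a≡ᵇz (≡⇒≡ᵇ a a refl))
...   | there z∈as with indexOf as z | indexOf-at as z z∈as
...     | suc k | _ , k≤ , eq = z<s , s≤s k≤ , eq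

∈⇒≤maxW : ∀ {xs z} → z ∈ xs → z ≤ maxW xs
∈⇒≤maxW {a ∷ as} (here refl) = m≤m⊔n a (maxW as)
∈⇒≤maxW {a ∷ as} (there z∈)  = ≤-trans (∈⇒≤maxW z∈) (m≤n⊔m a (maxW as))

maxW-least : ∀ {xs m} → All (_≤ m) xs → maxW xs ≤ m
maxW-least []         = z≤n
maxW-least (a≤ ∷ as≤) = ⊔-lub a≤ (maxW-least as≤)

-- Lists with the same elements

delete : ℕ → List ℕ → List ℕ
delete a []       = []
delete a (b ∷ bs) with a ≟ b
... | yes _ = bs
... | no  _ = b ∷ delete a bs

∈-delete⁻ : ∀ a xs {z} → z ∈ delete a xs → z ∈ xs
∈-delete⁻ a (b ∷ bs) z∈ with a ≟ b
∈-delete⁻ a (b ∷ bs) z∈          | yes _ = there z∈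
∈-delete⁻ a (b ∷ bs) (here z≡b)  | no  _ = here z≡b
∈-delete⁻ a (b ∷ bs) (there z∈)  | no  _ = there (∈-delete⁻ a bs z∈)

∈-delete-≢ : ∀ a xs {z} → Unique xs → z ∈ delete a xs → z ≢ a
∈-delete-≢ a (b ∷ bs) (b∉ ∷ u) z∈ with a ≟ b
∈-delete-≢ a (b ∷ bs) (b∉ ∷ u) z∈         | yes refl = λ z≡a → All.lookup b∉ z∈ (sym z≡a)
∈-delete-≢ a (b ∷ bs) (b∉ ∷ u) (here refl) | no  a≢b  = λ b≡a → a≢b (sym b≡a)
∈-delete-≢ a (b ∷ bs) (b∉ ∷ u) (there z∈)  | no  _    = ∈-delete-≢ a bs u z∈

∈-delete⁺ : ∀ a xs {z} → z ∈ xs → z ≢ a → z ∈ delete a xs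
∈-delete⁺ a (b ∷ bs) z∈ z≢a with a ≟ b
∈-delete⁺ a (b ∷ bs) (here refl) z≢a | yes refl = ⊥-elim (z≢a refl)
∈-delete⁺ a (b ∷ bs) (there z∈)  z≢a | yes _    = z∈
∈-delete⁺ a (b ∷ bs) (here z≡b)  z≢a | no  _    = here z≡b
∈-delete⁺ a (b ∷ bs) (there z∈)  z≢a | no  _    = there (∈-delete⁺ a bs z∈ z≢a)

delete-unique : ∀ a xs → Unique xs → Unique (delete a xs)
delete-unique a []       u = u
delete-unique a (b ∷ bs) (b∉ ∷ u) with a ≟ b
... | yes _ = u
... | no  _ = All.tabulate (All.lookup b∉ ∘ ∈-delete⁻ a bs) ∷ delete-unique a bs u

length-delete : ∀ a xs → a ∈ xs → length xs ≡ suc (length (delete a xs))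
length-delete a (b ∷ bs) a∈ with a ≟ b
... | yes _ = refl
... | no a≢b with a∈
...   | here a≡b  = ⊥-elim (a≢b a≡b)
...   | there a∈bs = cong suc (length-delete a bs a∈bs)

same-elements⇒length≡ : ∀ xs ys → Unique xs → Unique ys → xs ⊆ ys → ys ⊆ xs → length xs ≡ length ys
same-elements⇒length≡ [] [] _ _ _ _ = refl
same-elements⇒length≡ [] (y ∷ ys) _ _ _ ys⊆ with ys⊆ (here refl)
... | ()
same-elements⇒length≡ (x ∷ xs) ys (x∉ ∷ u) uys xs⊆ ys⊆ = begin
  suc (length xs)              ≡⟨ cong suc (same-elements⇒length≡ xs (delete x ys) u (delete-unique x ys uys)
                                                                  ⊆del del⊆) ⟩
  suc (length (delete x ys))   ≡⟨ sym (length-delete x ys (xs⊆ (here refl))) ⟩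
  length ys                    ∎
  where
  open ≡-Reasoning
  ⊆del : xs ⊆ delete x ys
  ⊆del z∈ = ∈-delete⁺ x ys (xs⊆ (there z∈)) (λ z≡x → All.lookup x∉ z∈ (sym z≡x))
  del⊆ : delete x ys ⊆ xs
  del⊆ z∈ with ys⊆ (∈-delete⁻ x ys z∈)
  ... | here z≡x  = ⊥-elim (∈-delete-≢ x ys uys z∈ z≡x)
  ... | there z∈xs = z∈xs

sorted-same-elements⇒≡ : ∀ {A : Set} {R : A → A → Set} → (∀ {a b} → R a b → ¬ R b a) →
  ∀ (xs ys : List A) → AllPairs R xs → AllPairs R ys → xs ⊆ ys → ys ⊆ xs → xs ≡ ys
sorted-same-elements⇒≡ asym [] [] _ _ _ _ = refl
sorted-same-elements⇒≡ asym [] (y ∷ ys) _ _ _ ys⊆ with ys⊆ (here refl)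
... | ()
sorted-same-elements⇒≡ asym (x ∷ xs) [] _ _ xs⊆ _ with xs⊆ (here refl)
... | ()
sorted-same-elements⇒≡ {R = R} asym (x ∷ xs) (y ∷ ys) (x~ ∷ xs↑) (y~ ∷ ys↑) xs⊆ ys⊆ with heads
  where
  heads : x ≡ y
  heads with xs⊆ (here refl) | ys⊆ (here refl)
  ... | here x≡y  | _         = x≡y
  ... | there _   | here y≡x  = sym y≡x
  ... | there x∈  | there y∈  = ⊥-elim (asym (All.lookup y~ x∈) (All.lookup x~ y∈))
... | refl = cong (x ∷_) (sorted-same-elements⇒≡ asym xs ys xs↑ ys↑ (tails x~ y~ xs⊆) (tails y~ x~ ys⊆))
  where
  tails : ∀ {us vs} → All (R x) us → All (R x) vs → (x ∷ us) ⊆ (x ∷ vs) → us ⊆ vs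
  tails us~ vs~ ⊆′ z∈ with ⊆′ (there z∈)
  ... | here refl = ⊥-elim (asym (All.lookup us~ z∈) (All.lookup us~ z∈))
  ... | there z∈′ = z∈′

AllPairs-map-with : ∀ {A B : Set} {P : A → Set} {R : A → A → Set} {S : B → B → Set} (f : A → B) →
  (∀ {a b} → P a → P b → R a b → S (f a) (f b)) →
  ∀ {xs} → All P xs → AllPairs R xs → AllPairs S (map f xs)
AllPairs-map-with f R⇒S []        []        = []
AllPairs-map-with f R⇒S (pa ∷ ps) (ra ∷ rs) =
  Allₚ.map⁺ (All.zipWith (λ (pb , r) → R⇒S pa pb r) (ps , ra)) ∷ AllPairs-map-with f R⇒S ps rs

map-unique-on : ∀ {A B : Set} (f : A → B) xs →
                (∀ {a b} → a ∈ xs → b ∈ xs → f a ≡ f b → a ≡ b) →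
                Unique xs → Unique (map f xs)
map-unique-on f xs injective =
  AllPairs-map-with f (λ a∈ b∈ a≢b → a≢b ∘ injective a∈ b∈) (All.tabulate id)

ids : ℕ → List ℕ
ids n = applyUpTo suc n

∈-ids⁺ : ∀ {n z} → 1 ≤ z → z ≤ n → z ∈ ids n
∈-ids⁺ {z = suc z} _ z< = ∈-applyUpTo⁺ suc z<

∈-ids⁻ : ∀ {n z} → z ∈ ids n → 1 ≤ z × z ≤ n
∈-ids⁻ z∈ with ∈-applyUpTo⁻ suc z∈
... | _ , i< , refl = z<s , i<

length-ids : ∀ n → length (ids n) ≡ n
length-ids = length-applyUpTo suc

at-ids : ∀ n s → 1 ≤ s → s ≤ n → at (ids n) s ≡ s
at-ids n (suc k) _ k< = at-applyUpTo suc n k k<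

ids-increasing : ∀ n → AllPairs _<_ (ids n)
ids-increasing n = AllPairsₚ.applyUpTo⁺₁ suc n (λ i<j _ → s<s i<j)

ids-unique : ∀ n → Unique (ids n)
ids-unique n = AllPairs.map <⇒≢ (ids-increasing n)

∈-zip⁻ : ∀ xs ys {a b} → (a , b) ∈ zip xs ys →
         ∃ λ s → 1 ≤ s × s ≤ length xs × s ≤ length ys × at xs s ≡ a × at ys s ≡ b
∈-zip⁻ (x ∷ xs) (y ∷ ys) (here refl) = 1 , z<s , s≤s z≤n , s≤s z≤n , refl , refl
∈-zip⁻ (x ∷ xs) (y ∷ ys) (there ab∈) with ∈-zip⁻ xs ys ab∈
... | suc s , _ , s≤xs , s≤ys , eqa , eqb = suc (suc s) , z<s , s≤s s≤xs , s≤s s≤ys , eqa , eqb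

∈-zip⁺ : ∀ xs ys s → 1 ≤ s → s ≤ length xs → s ≤ length ys → (at xs s , at ys s) ∈ zip xs ys
∈-zip⁺ (x ∷ xs) (y ∷ ys) (suc zero)    _ _ _ = here refl
∈-zip⁺ (x ∷ xs) (y ∷ ys) (suc (suc s)) _ (s≤s s≤xs) (s≤s s≤ys) =
  there (∈-zip⁺ xs ys (suc s) z<s s≤xs s≤ys)

zip-unique₁ : ∀ (xs ys : List ℕ) → Unique xs → Unique (zip xs ys)
zip-unique₁ []       _        _        = []
zip-unique₁ (x ∷ xs) []       _        = []
zip-unique₁ (x ∷ xs) (y ∷ ys) (x∉ ∷ u) =
  All.tabulate (λ z∈ xy≡z → x∉zip (subst (_∈ zip xs ys) (sym xy≡z) z∈)) ∷ zip-unique₁ xs ys u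
  where
  x∉zip : (x , y) ∉ zip xs ys
  x∉zip xy∈ = let s , 1≤s , s≤ , _ , eq , _ = ∈-zip⁻ xs ys xy∈ in All-at xs s x∉ 1≤s s≤ (sym eq)

zip-unique₂ : ∀ (xs ys : List ℕ) → Unique ys → Unique (zip xs ys)
zip-unique₂ []       _        _        = []
zip-unique₂ (x ∷ xs) []       _        = []
zip-unique₂ (x ∷ xs) (y ∷ ys) (y∉ ∷ u) =
  All.tabulate (λ z∈ xy≡z → y∉zip (subst (_∈ zip xs ys) (sym xy≡z) z∈)) ∷ zip-unique₂ xs ys u
  where
  y∉zip : (x , y) ∉ zip xs ys
  y∉zip xy∈ = let s , 1≤s , _ , s≤ , _ , eq = ∈-zip⁻ xs ys xy∈ in All-at ys s y∉ 1≤s s≤ (sym eq)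

-- Insertion sort of columns

Column : Set
Column = ℕ × ℕ

_⊑_ : Column → Column → Set
(a , b) ⊑ (c , d) = a < c ⊎ (a ≡ c × d ≤ b)

_⊏_ : Column → Column → Set
p ⊏ q = p ⊑ q × p ≢ q

colLeq⇒⊑ : ∀ p q → T (colLeq p q) → p ⊑ q
colLeq⇒⊑ (a , b) (c , d) t with Equivalence.to T-∨ t
... | inj₁ a<c = inj₁ (<ᵇ⇒< a c a<c)
... | inj₂ t′  with Equivalence.to T-∧ t′
... | a≡c , d≤b = inj₂ (≡ᵇ⇒≡ a c a≡c , ≤ᵇ⇒≤ d b d≤b)

⊑⇒colLeq : ∀ p q → p ⊑ q → T (colLeq p q)
⊑⇒colLeq (a , b) (c , d) (inj₁ a<c)        = Equivalence.from T-∨ (inj₁ (<⇒<ᵇ a<c))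
⊑⇒colLeq (a , b) (c , d) (inj₂ (a≡c , d≤b)) =
  Equivalence.from T-∨ (inj₂ (Equivalence.from T-∧ (≡⇒≡ᵇ a c a≡c , ≤⇒≤ᵇ d≤b)))

⊑-trans : ∀ {p q r} → p ⊑ q → q ⊑ r → p ⊑ r
⊑-trans (inj₁ a<c)         (inj₁ c<e)         = inj₁ (<-trans a<c c<e)
⊑-trans (inj₁ a<c)         (inj₂ (refl , _))  = inj₁ a<c
⊑-trans (inj₂ (refl , _))  (inj₁ c<e)         = inj₁ c<e
⊑-trans (inj₂ (refl , d≤b)) (inj₂ (refl , f≤d)) = inj₂ (refl , ≤-trans f≤d d≤b)

⊑-total : ∀ p q → ¬ p ⊑ q → q ⊑ p
⊑-total (a , b) (c , d) p⋢q with <-cmp a c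
... | tri< a<c _ _ = ⊥-elim (p⋢q (inj₁ a<c))
... | tri> _ _ c<a = inj₁ c<a
... | tri≈ _ refl _ with d ≤? b
...   | yes d≤b = ⊥-elim (p⋢q (inj₂ (refl , d≤b)))
...   | no  d≰b = inj₂ (refl , <⇒≤ (≰⇒> d≰b))

⊏-asym : ∀ {p q} → p ⊏ q → ¬ q ⊏ p
⊏-asym (inj₁ a<c         , _)   (inj₁ c<a , _)         = <-asym a<c c<a
⊏-asym (inj₁ a<c         , _)   (inj₂ (refl , _) , _)  = <-irrefl refl a<c
⊏-asym (inj₂ (refl , _)  , _)   (inj₁ c<a , _)         = <-irrefl refl c<a
⊏-asym (inj₂ (refl , d≤b) , p≢q) (inj₂ (_ , b≤d) , _)   = p≢q (cong (_ ,_) (≤-antisym b≤d d≤b))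

insertCol-↭ : ∀ p qs → insertCol p qs ↭ p ∷ qs
insertCol-↭ p []       = refl
insertCol-↭ p (q ∷ qs) with colLeq p q
... | true  = refl
... | false = trans (prep q (insertCol-↭ p qs)) (swap q p refl)

sortCols-↭ : ∀ qs → sortCols qs ↭ qs
sortCols-↭ []       = refl
sortCols-↭ (q ∷ qs) = trans (insertCol-↭ q (sortCols qs)) (prep q (sortCols-↭ qs))

insertCol-sorted : ∀ p qs → AllPairs _⊑_ qs → AllPairs _⊑_ (insertCol p qs)
insertCol-sorted p []       _          = [] ∷ []
insertCol-sorted p (q ∷ qs) (q⊑ ∷ qs↑) with colLeq p q in p≤q
... | true  = (p⊑q ∷ All.map (⊑-trans p⊑q) q⊑) ∷ q⊑ ∷ qs↑
  where p⊑q = colLeq⇒⊑ p q (subst T (sym p≤q) tt)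
... | false = All-resp-↭ (↭-sym (insertCol-↭ p qs)) (q⊑p ∷ q⊑) ∷ insertCol-sorted p qs qs↑
  where q⊑p = ⊑-total p q (λ p⊑q → subst T p≤q (⊑⇒colLeq p q p⊑q))

sortCols-sorted : ∀ qs → AllPairs _⊑_ (sortCols qs)
sortCols-sorted []       = []
sortCols-sorted (q ∷ qs) = insertCol-sorted q (sortCols qs) (sortCols-sorted qs)

sortCols-strictly-sorted : ∀ qs → Unique qs → AllPairs _⊏_ (sortCols qs)
sortCols-strictly-sorted qs u =
  AllPairs.zip (sortCols-sorted qs ,
                Permutationₛ.Unique-resp-↭ (setoid Column) (↭⇒↭ₛ (↭-sym (sortCols-↭ qs))) u)

-- Permutations and the Burge transpose

PermOf : ℕ → List ℕ → Set
PermOf n π = Unique π × π ⊆ ids n × ids n ⊆ π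

module Permutation {n π} (P : PermOf n π) where

  length-π : length π ≡ n
  length-π = ≡-trans (same-elements⇒length≡ π (ids n) (proj₁ P) (ids-unique n)
                                           (proj₁ (proj₂ P)) (proj₂ (proj₂ P)))
                     (length-ids n)

  π-range : ∀ s → 1 ≤ s → s ≤ n → 1 ≤ at π s × at π s ≤ n
  π-range s 1≤s s≤n = ∈-ids⁻ (proj₁ (proj₂ P) (at-∈ π s 1≤s (subst (s ≤_) (sym length-π) s≤n)))

  π-injective : ∀ s t → 1 ≤ s → s ≤ n → 1 ≤ t → t ≤ n → at π s ≡ at π t → s ≡ t
  π-injective s t 1≤s s≤n 1≤t t≤n =
    at-injective π s t (proj₁ P) 1≤s (subst (s ≤_) (sym length-π) s≤n)
                                 1≤t (subst (t ≤_) (sym length-π) t≤n)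

  inv : ℕ → ℕ
  inv = indexOf π

  inv-spec : ∀ k → 1 ≤ k → k ≤ n → 1 ≤ inv k × inv k ≤ n × at π (inv k) ≡ k
  inv-spec k 1≤k k≤n with indexOf-at π k (proj₂ (proj₂ P) (∈-ids⁺ 1≤k k≤n))
  ... | 1≤ , ≤len , eq = 1≤ , subst (inv k ≤_) length-π ≤len , eq

  inv-range : ∀ k → 1 ≤ k → k ≤ n → 1 ≤ inv k × inv k ≤ n
  inv-range k 1≤k k≤n = let 1≤ , ≤n , _ = inv-spec k 1≤k k≤n in 1≤ , ≤n

  π-inv : ∀ k → 1 ≤ k → k ≤ n → at π (inv k) ≡ k
  π-inv k 1≤k k≤n = proj₂ (proj₂ (inv-spec k 1≤k k≤n))

  inv-π : ∀ s → 1 ≤ s → s ≤ n → inv (at π s) ≡ s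
  inv-π s 1≤s s≤n =
    let 1≤π , π≤n = π-range s 1≤s s≤n
        1≤ , ≤n , eq = inv-spec (at π s) 1≤π π≤n
    in π-injective _ s 1≤ ≤n 1≤s s≤n eq

  Γ-inv : ∀ u → length u ≡ n → Γ u π ≡ map (λ k → at u (inv k)) (ids n)
  Γ-inv u len-u = begin
    map proj₂ (sortCols (zip π u))               ≡⟨ cong (map proj₂) sorted ⟩
    map proj₂ (map column (ids n))               ≡⟨ map-∘ (ids n) ⟨
    map (λ k → at u (inv k)) (ids n)             ∎
    where
    open ≡-Reasoning
    column : ℕ → Column
    column k = k , at u (inv k)

    zip⊆ : sortCols (zip π u) ⊆ map column (ids n)
    zip⊆ {a , b} ab∈ with ∈-zip⁻ π u (∈-resp-↭ (sortCols-↭ (zip π u)) ab∈)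
    ... | s , 1≤s , s≤π , _ , refl , refl =
      subst (_∈ map column (ids n)) (cong (at π s ,_) (cong (at u) (inv-π s 1≤s s≤n)))
            (∈-map⁺ column (∈-ids⁺ 1≤a a≤n))
      where
      s≤n = subst (s ≤_) length-π s≤π
      1≤a = proj₁ (π-range s 1≤s s≤n)
      a≤n = proj₂ (π-range s 1≤s s≤n)

    ⊆zip : map column (ids n) ⊆ sortCols (zip π u)
    ⊆zip c∈ with ∈-map⁻ column c∈
    ... | k , k∈ , refl with ∈-ids⁻ k∈
    ... | 1≤k , k≤n with inv-spec k 1≤k k≤n
    ... | 1≤ , ≤n , eq =
      ∈-resp-↭ (↭-sym (sortCols-↭ (zip π u)))
        (subst (λ a → (a , at u (inv k)) ∈ zip π u) eq
          (∈-zip⁺ π u (inv k) 1≤ (subst (inv k ≤_) (sym length-π) ≤n)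
                                 (subst (inv k ≤_) (sym len-u) ≤n)))

    columns-increasing : AllPairs _⊏_ (map column (ids n))
    columns-increasing =
      AllPairsₚ.map⁺ (AllPairs.map (λ k<l → inj₁ k<l , <⇒≢ k<l ∘ cong proj₁) (ids-increasing n))

    sorted : sortCols (zip π u) ≡ map column (ids n)
    sorted = sorted-same-elements⇒≡ ⊏-asym _ _
      (sortCols-strictly-sorted (zip π u) (zip-unique₁ π u (proj₁ P))) columns-increasing zip⊆ ⊆zip

  length-Γ : ∀ u → length u ≡ n → length (Γ u π) ≡ n
  length-Γ u len-u = begin
    length (Γ u π)                              ≡⟨ cong length (Γ-inv u len-u) ⟩
    length (map (λ k → at u (inv k)) (ids n))   ≡⟨ length-map _ (ids n) ⟩
    length (ids n)                              ≡⟨ length-ids n ⟩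
    n                                           ∎
    where open ≡-Reasoning

  at-Γ : ∀ u → length u ≡ n → ∀ k → 1 ≤ k → k ≤ n → at (Γ u π) k ≡ at u (inv k)
  at-Γ u len-u k 1≤k k≤n = begin
    at (Γ u π) k                                    ≡⟨ cong (λ w → at w k) (Γ-inv u len-u) ⟩
    at (map (λ k → at u (inv k)) (ids n)) k         ≡⟨ at-map _ (ids n) k 1≤k
                                                         (subst (k ≤_) (sym (length-ids n)) k≤n) ⟩
    at u (inv (at (ids n) k))                       ≡⟨ cong (at u ∘ inv) (at-ids n k 1≤k k≤n) ⟩
    at u (inv k)                                    ∎
    where open ≡-Reasoning

IsPerm⇒PermOf : ∀ π → IsPerm π → PermOf (length π) π
IsPerm⇒PermOf π ((positive , covers) , u) =
  subst (λ m → PermOf m π) (sym (Permutation.length-π P)) P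
  where
  P : PermOf (maxW π) π
  P = u , (λ z∈ → ∈-ids⁺ (All.lookup positive z∈) (∈⇒≤maxW z∈))
        , (λ z∈ → let 1≤z , z≤ = ∈-ids⁻ z∈ in covers _ 1≤z z≤)

PermOf⇒IsPerm : ∀ {n π} → PermOf n π → IsPerm π
PermOf⇒IsPerm {n} {π} (u , π⊆ , ⊆π) =
  (All.tabulate (proj₁ ∘ ∈-ids⁻ ∘ π⊆) ,
   λ k 1≤k k≤max → ⊆π (∈-ids⁺ 1≤k (≤-trans k≤max (maxW-least (All.tabulate (proj₂ ∘ ∈-ids⁻ ∘ π⊆))))))
  , u

-- Active sites

module ActiveSites (π : List ℕ) where

  A : ℕ → ℕ
  A = activeBelow π

  A-suc : ∀ s → A (suc s) ≡ A s + (if active π s then 1 else 0)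
  A-suc s = begin
    sum (map bit (upTo (suc s)))           ≡⟨ cong (sum ∘ map bit) (upTo-∷ʳ s) ⟨
    sum (map bit (upTo s ++ s ∷ []))       ≡⟨ cong sum (map-++ bit (upTo s) (s ∷ [])) ⟩
    sum (map bit (upTo s) ++ bit s ∷ [])   ≡⟨ sum-++ (map bit (upTo s)) (bit s ∷ []) ⟩
    A s + (bit s + 0)                      ≡⟨ cong (A s +_) (+-identityʳ (bit s)) ⟩
    A s + bit s                            ∎
    where
    open ≡-Reasoning
    bit : ℕ → ℕ
    bit s = if active π s then 1 else 0

  A-step : ∀ s → (T (active π s) × A (suc s) ≡ suc (A s)) ⊎ (¬ T (active π s) × A (suc s) ≡ A s)
  A-step s with active π s | A-suc s
  ... | true  | eq = inj₁ (tt , ≡-trans eq (+-comm (A s) 1))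
  ... | false | eq = inj₂ ((λ ()) , ≡-trans eq (+-identityʳ (A s)))

  A-≤-suc : ∀ s → A s ≤ A (suc s)
  A-≤-suc s with A-step s
  ... | inj₁ (_ , eq) = ≤-trans (n≤1+n (A s)) (≤-reflexive (sym eq))
  ... | inj₂ (_ , eq) = ≤-reflexive (sym eq)

  A-suc-≤ : ∀ s → A (suc s) ≤ suc (A s)
  A-suc-≤ s with A-step s
  ... | inj₁ (_ , eq) = ≤-reflexive eq
  ... | inj₂ (_ , eq) = ≤-trans (≤-reflexive eq) (n≤1+n (A s))

  A-mono : ∀ {s t} → s ≤ t → A s ≤ A t
  A-mono {s} {t} s≤t with m≤n⇒m<n∨m≡n s≤t
  ... | inj₂ refl = ≤-refl
  A-mono {s} {suc t} _ | inj₁ (s≤s s≤t) = ≤-trans (A-mono s≤t) (A-≤-suc t)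

  A-mono⁻¹ : ∀ {s t} → A s < A t → s < t
  A-mono⁻¹ {s} {t} As<At with s <? t
  ... | yes s<t = s<t
  ... | no  s≮t = ⊥-elim (<⇒≱ As<At (A-mono (≮⇒≥ s≮t)))

  A-one : A 1 ≡ 1
  A-one = refl

  A-positive : ∀ {s} → 1 ≤ s → 1 ≤ A s
  A-positive {s} 1≤s = subst (_≤ A s) A-one (A-mono 1≤s)

  flat⇒inactive : ∀ s → A (suc s) ≡ A s → ¬ T (active π s)
  flat⇒inactive s flat with A-step s
  ... | inj₁ (_ , rise) = λ _ → 1+n≢n (≡-trans (sym rise) flat)
  ... | inj₂ (s-inactive , _) = s-inactive

  rise⇒active : ∀ s → A (suc s) ≡ suc (A s) → T (active π s)
  rise⇒active s rise with A-step s
  ... | inj₁ (s-active , _) = s-active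
  ... | inj₂ (_ , flat) = ⊥-elim (1+n≢n (≡-trans (sym rise) flat))

  active⇒rise : ∀ s → T (active π s) → A (suc s) ≡ suc (A s)
  active⇒rise s s-active with A-step s
  ... | inj₁ (_ , rise) = rise
  ... | inj₂ (s-inactive , _) = ⊥-elim (s-inactive s-active)

  inactive⇒flat : ∀ s → ¬ T (active π s) → A (suc s) ≡ A s
  inactive⇒flat s s-inactive with A-step s
  ... | inj₁ (s-active , _) = ⊥-elim (s-inactive s-active)
  ... | inj₂ (_ , flat) = flat

  -- A only ever steps by one, so it takes every value between A p and A q.
  A-crosses : ∀ p q c → p ≤ q → A p ≤ c → c < A q →
              ∃ λ s → p ≤ s × s < q × A s ≡ c × A (suc s) ≡ suc c
  A-crosses p zero c p≤q Ap≤c ()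
  A-crosses p (suc q) c p≤q Ap≤c c<Aq with m≤n⇒m<n∨m≡n p≤q
  ... | inj₂ refl = ⊥-elim (<-irrefl refl (≤-trans c<Aq Ap≤c))
  ... | inj₁ (s≤s p≤q′) with A q ≤? c
  ...   | yes Aq≤c = q , p≤q′ , n<1+n q , Aq≡c , A-suc≡
    where
    A-suc≡ : A (suc q) ≡ suc c
    A-suc≡ = ≤-antisym (≤-trans (A-suc-≤ q) (s≤s Aq≤c)) c<Aq
    Aq≡c : A q ≡ c
    Aq≡c = ≤-antisym Aq≤c (s≤s⁻¹ (subst (_≤ suc (A q)) A-suc≡ (A-suc-≤ q)))
  ...   | no Aq≰c with A-crosses p q c p≤q′ Ap≤c (≰⇒> Aq≰c)
  ...     | s , p≤s , s<q , eq , eq′ = s , p≤s , m<n⇒m<1+n s<q , eq , eq′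

  at-υ̃ : ∀ j → 1 ≤ j → j ≤ length π → at (υ̃ π) j ≡ A j
  at-υ̃ (suc k) 1≤j j≤ = begin
    at (υ̃ π) (suc k)                    ≡⟨ at-map (A ∘ suc) (upTo (length π)) (suc k) 1≤j
                                              (subst (suc k ≤_) (sym (length-applyUpTo id (length π))) j≤) ⟩
    A (suc (at (upTo (length π)) (suc k))) ≡⟨ cong (A ∘ suc) (at-applyUpTo id (length π) k j≤) ⟩
    A (suc k)                            ∎
    where open ≡-Reasoning

  length-υ̃ : length (υ̃ π) ≡ length π
  length-υ̃ = ≡-trans (length-map (A ∘ suc) (upTo (length π))) (length-applyUpTo id (length π))

suc-∸1 : ∀ {m} → 1 ≤ m → suc (m ∸ 1) ≡ m
suc-∸1 (s≤s _) = refl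

if-≡ᵇ : ∀ m k (a b : ℕ) →
         (m ≡ k × (if m ≡ᵇ k then a else b) ≡ a) ⊎ (m ≢ k × (if m ≡ᵇ k then a else b) ≡ b)
if-≡ᵇ m k a b with m ≡ᵇ k in eq
... | true  = inj₁ (≡ᵇ⇒≡ m k (subst T (sym eq) tt) , refl)
... | false = inj₂ ((λ m≡k → subst T eq (≡⇒≡ᵇ m k m≡k)) , refl)

module Sites {n π} (P : PermOf n π) where
  open Permutation P public
  open ActiveSites π public

  J-cases : ∀ s → (at π s ≡ 1 × J π s ≡ 0) ⊎ (at π s ≢ 1 × J π s ≡ inv (at π s ∸ 1))
  J-cases s = if-≡ᵇ (at π s) 1 0 (inv (at π s ∸ 1))

  J<⇔ : ∀ s → 1 ≤ s → J π s < s ⇔ (at π s ≡ 1 ⊎ inv (at π s ∸ 1) < s)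
  J<⇔ s 1≤s with J-cases s
  ... | inj₁ (π≡1 , J≡0) = mk⇔ (λ _ → inj₁ π≡1) (λ _ → subst (_< s) (sym J≡0) 1≤s)
  ... | inj₂ (π≢1 , J≡)  = mk⇔ (inj₂ ∘ subst (_< s) J≡) [ ⊥-elim ∘ π≢1 , subst (_< s) (sym J≡) ]

  ActiveReason : ℕ → Set
  ActiveReason s = at π s ≡ 1 ⊎ inv (at π s ∸ 1) < s ⊎ at π s < at π (suc s)

  active⇔reason : ∀ s → 1 ≤ s → s < n → T (active π s) ⇔ ActiveReason s
  active⇔reason (suc i) 1≤s s<n = mk⇔ to from
    where
    s = suc i
    to : T (active π s) → ActiveReason s
    to t with Equivalence.to T-∨ t
    ... | inj₁ J<s = map₂ inj₁ (Equivalence.to (J<⇔ s 1≤s) (<ᵇ⇒< _ _ J<s))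
    ... | inj₂ asc = inj₂ (inj₂ (<ᵇ⇒< _ _ (proj₂ (Equivalence.to T-∧ asc))))
    J<s⇒active : at π s ≡ 1 ⊎ inv (at π s ∸ 1) < s → T (active π s)
    J<s⇒active = Equivalence.from T-∨ ∘ inj₁ ∘ <⇒<ᵇ ∘ Equivalence.from (J<⇔ s 1≤s)
    from : ActiveReason s → T (active π s)
    from (inj₁ π≡1)         = J<s⇒active (inj₁ π≡1)
    from (inj₂ (inj₁ inv<)) = J<s⇒active (inj₂ inv<)
    from (inj₂ (inj₂ asc))  =
      Equivalence.from T-∨ (inj₂ (Equivalence.from T-∧ (<⇒<ᵇ (subst (s <_) (sym length-π) s<n) , <⇒<ᵇ asc)))

  inactive⇒descent : ∀ s → 1 ≤ s → s < n → ¬ T (active π s) → at π (suc s) < at π s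
  inactive⇒descent s 1≤s s<n inactive =
    ≤∧≢⇒< (≮⇒≥ (inactive ∘ Equivalence.from (active⇔reason s 1≤s s<n) ∘ inj₂ ∘ inj₂))
          (1+n≢n ∘ π-injective (suc s) s z<s s<n 1≤s (<⇒≤ s<n))

  inactive⇒predecessor-after : ∀ s → 1 ≤ s → s < n → ¬ T (active π s) → s < inv (at π s ∸ 1)
  inactive⇒predecessor-after s 1≤s s<n inactive =
    ≤∧≢⇒< (≮⇒≥ (no-reason ∘ inj₂ ∘ inj₁))
          (λ s≡ → <-irrefl (sym (≡-trans (cong (at π) s≡) π-pred)) (∸-monoʳ-< {o = 0} z<s 1≤πs))
    where
    no-reason : ¬ ActiveReason s
    no-reason = inactive ∘ Equivalence.from (active⇔reason s 1≤s s<n)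
    1≤πs = proj₁ (π-range s 1≤s (<⇒≤ s<n))
    2≤πs : 2 ≤ at π s
    2≤πs = ≤∧≢⇒< 1≤πs (no-reason ∘ inj₁ ∘ sym)
    π-pred : at π (inv (at π s ∸ 1)) ≡ at π s ∸ 1
    π-pred = π-inv (at π s ∸ 1) (∸-monoˡ-≤ 1 2≤πs)
                   (≤-trans (m∸n≤m (at π s) 1) (proj₂ (π-range s 1≤s (<⇒≤ s<n))))

  -- A s ≡ A t makes every site from s to t − 1 inactive, and π descends across an inactive site.
  descending-run : ∀ s t → 1 ≤ s → s < t → t ≤ n → A s ≡ A t → at π t < at π s
  descending-run s (suc t) 1≤s (s≤s s≤t) t<n As≡At with m≤n⇒m<n∨m≡n s≤t
  ... | inj₂ refl = inactive⇒descent s 1≤s t<n (flat⇒inactive s (sym As≡At))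
  ... | inj₁ s<t  = <-trans (inactive⇒descent t (≤-trans 1≤s (<⇒≤ s<t)) t<n (flat⇒inactive t (sym At≡))) run
    where
    At≡ : A t ≡ A (suc t)
    At≡ = ≤-antisym (A-≤-suc t) (subst (_≤ A t) As≡At (A-mono (<⇒≤ s<t)))
    run : at π t < at π s
    run = descending-run s t 1≤s s<t (<⇒≤ t<n) (≡-trans As≡At (sym At≡))

  η-length : length (η π) ≡ n
  η-length = length-Γ (υ̃ π) (≡-trans length-υ̃ length-π)

  η-at : ∀ k → 1 ≤ k → k ≤ n → at (η π) k ≡ A (inv k)
  η-at k 1≤k k≤n = ≡-trans (at-Γ (υ̃ π) (≡-trans length-υ̃ length-π) k 1≤k k≤n)
                           (at-υ̃ (inv k) 1≤ (subst (inv k ≤_) (sym length-π) ≤n))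
    where 1≤ = proj₁ (inv-range k 1≤k k≤n)
          ≤n = proj₂ (inv-range k 1≤k k≤n)

  η-at-π : ∀ s → 1 ≤ s → s ≤ n → at (η π) (at π s) ≡ A s
  η-at-π s 1≤s s≤n = ≡-trans (η-at (at π s) (proj₁ (π-range s 1≤s s≤n)) (proj₂ (π-range s 1≤s s≤n)))
                             (cong A (inv-π s 1≤s s≤n))

-- From permutations to pattern avoiders

Precedes : List ℕ → ℕ → ℕ → Set
Precedes x a b = at x a < at x b ⊎ (at x a ≡ at x b × b < a)

Precedes-asym : ∀ {x a b} → Precedes x a b → ¬ Precedes x b a
Precedes-asym (inj₁ lt)       (inj₁ gt)       = <-asym lt gt
Precedes-asym (inj₁ lt)       (inj₂ (eq , _)) = <-irrefl (sym eq) lt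
Precedes-asym (inj₂ (eq , _)) (inj₁ gt)       = <-irrefl (sym eq) gt
Precedes-asym (inj₂ (_ , lt)) (inj₂ (_ , gt)) = <-asym lt gt

Precedes⇒≢ : ∀ {x a b} → Precedes x a b → a ≢ b
Precedes⇒≢ (inj₁ lt)       refl = <-irrefl refl lt
Precedes⇒≢ (inj₂ (_ , lt)) refl = <-irrefl refl lt

-- 𝔠 and 𝔡 merged into one pattern: 𝔡 is its case i = j.
ShadedDescent : List ℕ → ℕ → ℕ → Set
ShadedDescent x i j =
  1 ≤ i × j < length x × at x (suc j) < at x i × (i ≡ j ⊎ i < j × at x i < at x j) ×
  (∀ p → 1 ≤ p → p < j → p ≢ i → ¬ (at x (suc j) ≤ at x p × at x p < at x i)) ×
  (∀ p → suc j < p → p ≤ length x → ¬ (at x (suc j) < at x p × at x p ≤ at x i))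

ContainsShadedDescent : List ℕ → Set
ContainsShadedDescent x = ∃ λ i → ∃ λ j → ShadedDescent x i j

shadedDescent⇔𝔠⊎𝔡 : ∀ x → ContainsShadedDescent x ⇔ (Contains𝔠 x ⊎ Contains𝔡 x)
shadedDescent⇔𝔠⊎𝔡 x = mk⇔ to from
  where
  to : ContainsShadedDescent x → Contains𝔠 x ⊎ Contains𝔡 x
  to (i , .i , 1≤i , i< , xk<xi , inj₁ refl , left , right) =
    inj₂ (i , 1≤i , i< , xk<xi , (λ p 1≤p p<i → left p 1≤p p<i (<⇒≢ p<i)) , right)
  to (i , j , 1≤i , j< , xk<xi , inj₂ (i<j , xi<xj) , left , right) =
    inj₁ (i , j , 1≤i , i<j , j< , xk<xi , xi<xj , left , right)
  from : Contains𝔠 x ⊎ Contains𝔡 x → ContainsShadedDescent x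
  from (inj₁ (i , j , 1≤i , i<j , j< , xk<xi , xi<xj , left , right)) =
    i , j , 1≤i , j< , xk<xi , inj₂ (i<j , xi<xj) , left , right
  from (inj₂ (i , 1≤i , i< , xk<xi , left , right)) =
    i , i , 1≤i , i< , xk<xi , inj₁ refl , (λ p 1≤p p<i _ → left p 1≤p p<i) , right

module EtaOfPermutation {n π} (P : PermOf n π) where
  open Sites P

  private
    x = η π
    ≤n : ∀ {k} → k ≤ length x → k ≤ n
    ≤n = subst (_ ≤_) η-length

  A∈η : ∀ s → 1 ≤ s → s ≤ n → A s ∈ x
  A∈η s 1≤s s≤n =
    subst (_∈ x) (η-at-π s 1≤s s≤n) (at-∈ x (at π s) 1≤πs (subst (at π s ≤_) (sym η-length) πs≤n))
    where 1≤πs = proj₁ (π-range s 1≤s s≤n)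
          πs≤n = proj₂ (π-range s 1≤s s≤n)

  ∈η⇒A : ∀ {z} → z ∈ x → ∃ λ s → 1 ≤ s × s ≤ n × A s ≡ z
  ∈η⇒A z∈ with ∈⇒at z∈
  ... | k , 1≤k , k≤ , refl = inv k , proj₁ (inv-range k 1≤k (≤n k≤)) , proj₂ (inv-range k 1≤k (≤n k≤))
                             , sym (η-at k 1≤k (≤n k≤))

  η-Cayley : IsCayley x
  η-Cayley = All.tabulate positive , covers
    where
    positive : ∀ {z} → z ∈ x → 1 ≤ z
    positive z∈ = let s , 1≤s , _ , eq = ∈η⇒A z∈ in subst (1 ≤_) eq (A-positive 1≤s)
    max≤An : maxW x ≤ A n
    max≤An = maxW-least (All.tabulate λ z∈ →
               let s , _ , s≤n , eq = ∈η⇒A z∈ in subst (_≤ A n) eq (A-mono s≤n))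
    covers : ∀ b → 1 ≤ b → b ≤ maxW x → b ∈ x
    covers (suc c) _ b≤max with A-crosses 0 n c z≤n z≤n (≤-trans b≤max max≤An)
    ... | s , _ , s<n , _ , eq = subst (_∈ x) eq (A∈η (suc s) z<s s<n)

  -- x(i) = x(j+1) keeps A level between inv i and inv (j+1).  If inv i comes first π descends
  -- there, against i < j+1; otherwise site inv (j+1) is inactive, so inv j lies after it and
  -- x(j) ≥ x(j+1).
  η-avoids-𝔞 : ¬ Contains𝔞 x
  η-avoids-𝔞 (i , j , 1≤i , i<j , j< , xj<xi , xi≡xk) = by-position (<-cmp (inv i) (inv k))
    where
    k = suc j
    k≤n = ≤n j<
    i≤n = ≤-trans (<⇒≤ i<j) (<⇒≤ k≤n)
    Ai≡Ak : A (inv i) ≡ A (inv k)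
    Ai≡Ak = ≡-trans (sym (η-at i 1≤i i≤n)) (≡-trans xi≡xk (η-at k z<s k≤n))
    Aj<Ai : A (inv j) < A (inv i)
    Aj<Ai = subst₂ _<_ (η-at j (≤-trans 1≤i (<⇒≤ i<j)) (<⇒≤ k≤n)) (η-at i 1≤i i≤n) xj<xi
    by-position : Tri (inv i < inv k) (inv i ≡ inv k) (inv i > inv k) → ⊥
    by-position (tri≈ _ inv≡ _) =
      <-irrefl (≡-trans (sym (π-inv i 1≤i i≤n)) (≡-trans (cong (at π) inv≡) (π-inv k z<s k≤n)))
               (m<n⇒m<1+n i<j)
    by-position (tri< inv< _ _) =
      <-asym (m<n⇒m<1+n i<j)
        (subst₂ _<_ (π-inv k z<s k≤n) (π-inv i 1≤i i≤n)
          (descending-run (inv i) (inv k) (proj₁ (inv-range i 1≤i i≤n)) inv<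
                          (proj₂ (inv-range k z<s k≤n)) Ai≡Ak))
    by-position (tri> _ _ inv>) =
      <-irrefl refl (<-≤-trans Aj<Ai (subst (_≤ A (inv j)) (sym Ai≡Ak) (A-mono (<⇒≤ k-before-j))))
      where
      flat : A (suc (inv k)) ≡ A (inv k)
      flat = ≤-antisym (subst (A (suc (inv k)) ≤_) Ai≡Ak (A-mono inv>)) (A-≤-suc (inv k))
      k-before-j : inv k < inv j
      k-before-j = subst (λ v → inv k < inv (v ∸ 1)) (π-inv k z<s k≤n)
                     (inactive⇒predecessor-after (inv k) (proj₁ (inv-range k z<s k≤n))
                                                 (<-≤-trans inv> (proj₂ (inv-range i 1≤i i≤n)))
                                                 (flat⇒inactive (inv k) flat))

  -- A rises from x(j+1) to x(i) at some site s between inv (j+1) and inv i.  The shadings force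
  -- π(s) = j+1 and π(s+1) < π(s), while j = π(s) − 1 sits after s; so s has no reason to be active.
  η-avoids-shaded-descent : ¬ ContainsShadedDescent x
  η-avoids-shaded-descent (i , j , 1≤i , j< , xk<xi , i≤j-cases , left , right) =
    no-rising-site (A-crosses (inv k) (inv i) (at x k) (<⇒≤ (A-mono⁻¹ Ak<Ai)) (≤-reflexive (sym xk≡))
                              (subst (at x k <_) xi≡ xk<xi))
    where
    k = suc j
    j<n = ≤n j<
    i≤j : i ≤ j
    i≤j = [ ≤-reflexive , <⇒≤ ∘ proj₁ ] i≤j-cases
    xi≤xj : at x i ≤ at x j
    xi≤xj = [ ≤-reflexive ∘ cong (at x) , <⇒≤ ∘ proj₂ ] i≤j-cases
    i≤n = ≤-trans i≤j (<⇒≤ j<n)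
    xk≡ : at x k ≡ A (inv k)
    xk≡ = η-at k z<s j<n
    xi≡ : at x i ≡ A (inv i)
    xi≡ = η-at i 1≤i i≤n
    Ak<Ai = subst₂ _<_ xk≡ xi≡ xk<xi
    no-rising-site : ¬ (∃ λ s → inv k ≤ s × s < inv i × A s ≡ at x k × A (suc s) ≡ suc (at x k))
    no-rising-site (s , invk≤s , s<invi , As≡ , Asuc≡) =
      unreasonable (Equivalence.to (active⇔reason s 1≤s s<n) s-active)
      where
      1≤s = ≤-trans (proj₁ (inv-range k z<s j<n)) invk≤s
      s<n = <-≤-trans s<invi (proj₂ (inv-range i 1≤i i≤n))
      s-active : T (active π s)
      s-active = rise⇒active s (≡-trans Asuc≡ (cong suc (sym As≡)))
      v = at π s
      w = at π (suc s)
      xv : at x v ≡ at x k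
      xv = ≡-trans (η-at-π s 1≤s (<⇒≤ s<n)) As≡
      xw : at x w ≡ suc (at x k)
      xw = ≡-trans (η-at-π (suc s) z<s s<n) Asuc≡
      1≤v = proj₁ (π-range s 1≤s (<⇒≤ s<n))
      k≤v : k ≤ v
      k≤v with <-cmp v j
      ... | tri> _ _ j<v = j<v
      ... | tri≈ _ refl _ = ⊥-elim (<-irrefl refl (<-≤-trans xk<xi (subst (at x i ≤_) xv xi≤xj)))
      ... | tri< v<j _ _ with v ≟ i
      ...   | yes refl = ⊥-elim (<-irrefl (sym xv) xk<xi)
      ...   | no v≢i   = ⊥-elim (left v 1≤v v<j v≢i (≤-reflexive (sym xv) , subst (_< at x i) (sym xv) xk<xi))
      v≤k : v ≤ k
      v≤k with m≤n⇒m<n∨m≡n invk≤s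
      ... | inj₂ refl   = ≤-reflexive (π-inv k z<s j<n)
      ... | inj₁ invk<s = <⇒≤ (subst (v <_) (π-inv k z<s j<n)
                            (descending-run (inv k) s (proj₁ (inv-range k z<s j<n)) invk<s (<⇒≤ s<n)
                                            (≡-trans (sym xk≡) (sym As≡))))
      v≡k : v ≡ k
      v≡k = ≤-antisym v≤k k≤v
      w<v : w < v
      w<v with <-cmp w v
      ... | tri< w<v _ _ = w<v
      ... | tri≈ _ w≡v _ = ⊥-elim (1+n≢n (π-injective (suc s) s z<s s<n 1≤s (<⇒≤ s<n) w≡v))
      ... | tri> _ _ v<w = ⊥-elim (right w (subst (_< w) v≡k v<w)
                                         (subst (w ≤_) (sym η-length) (proj₂ (π-range (suc s) z<s s<n)))
                                    (subst (at x k <_) (sym xw) (n<1+n _) , subst (_≤ at x i) (sym xw) xk<xi))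
      s<invj : s < inv j
      s<invj = A-mono⁻¹ (subst₂ _<_ (sym As≡) (η-at j (≤-trans 1≤i i≤j) (<⇒≤ j<n))
                          (<-≤-trans xk<xi xi≤xj))
      unreasonable : ¬ ActiveReason s
      unreasonable (inj₁ v≡1)         = <-irrefl (≡-trans (sym v≡1) v≡k) (s<s (≤-trans 1≤i i≤j))
      unreasonable (inj₂ (inj₁ inv<)) = <-asym inv< (subst (λ u → s < inv (u ∸ 1)) (sym v≡k) s<invj)
      unreasonable (inj₂ (inj₂ v<w))  = <-asym v<w w<v

  η-avoids-𝔠 : ¬ Contains𝔠 x
  η-avoids-𝔠 = η-avoids-shaded-descent ∘ Equivalence.from (shadedDescent⇔𝔠⊎𝔡 x) ∘ inj₁

  η-avoids-𝔡 : ¬ Contains𝔡 x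
  η-avoids-𝔡 = η-avoids-shaded-descent ∘ Equivalence.from (shadedDescent⇔𝔠⊎𝔡 x) ∘ inj₂

  η-sorted : AllPairs (Precedes x) π
  η-sorted = at⇒AllPairs π λ s t 1≤s s<t t≤ → by-A s t 1≤s s<t (subst (t ≤_) length-π t≤)
    where
    by-A : ∀ s t → 1 ≤ s → s < t → t ≤ n → Precedes x (at π s) (at π t)
    by-A s t 1≤s s<t t≤n with m≤n⇒m<n∨m≡n (A-mono {s} {t} (<⇒≤ s<t))
    ... | inj₁ As<At = inj₁ (subst₂ _<_ (sym (η-at-π s 1≤s s≤n)) (sym (η-at-π t 1≤t t≤n)) As<At)
      where s≤n = ≤-trans (<⇒≤ s<t) t≤n
            1≤t = ≤-trans 1≤s (<⇒≤ s<t)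
    ... | inj₂ As≡At = inj₂ (≡-trans (η-at-π s 1≤s s≤n) (≡-trans As≡At (sym (η-at-π t 1≤t t≤n)))
                           , descending-run s t 1≤s s<t t≤n As≡At)
      where s≤n = ≤-trans (<⇒≤ s<t) t≤n
            1≤t = ≤-trans 1≤s (<⇒≤ s<t)

  η-Cayley-avoider : IsCayley x × Avoids𝔞𝔠𝔡 x
  η-Cayley-avoider = η-Cayley , η-avoids-𝔞 , η-avoids-𝔠 , η-avoids-𝔡

η-injective : ∀ {n π π′} → PermOf n π → PermOf n π′ → η π ≡ η π′ → π ≡ π′
η-injective {π = π} {π′} P@(_ , π⊆ , ⊆π) P′@(_ , π′⊆ , ⊆π′) η≡ =
  sorted-same-elements⇒≡ (λ {a} {b} → Precedes-asym {η π} {a} {b}) π π′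
    (EtaOfPermutation.η-sorted P)
    (subst (λ y → AllPairs (Precedes y) π′) (sym η≡) (EtaOfPermutation.η-sorted P′))
    (⊆π′ ∘ π⊆) (⊆π ∘ π′⊆)

-- From pattern avoiders to permutations

module Reading (x : List ℕ) where

  n : ℕ
  n = length x

  -- the positions of x by increasing value, right to left among equal values
  π : List ℕ
  π = Γ (ids n) x

  private
    columns = zip x (ids n)

    Shape : Column → Set
    Shape (a , w) = 1 ≤ w × w ≤ n × a ≡ at x w

  column-shape : ∀ {c} → c ∈ sortCols columns → Shape c
  column-shape c∈ with ∈-zip⁻ x (ids n) (∈-resp-↭ (sortCols-↭ columns) c∈)
  ... | s , 1≤s , s≤n , _ , refl , refl rewrite at-ids n s 1≤s s≤n = 1≤s , s≤n , refl

  π-sorted : AllPairs (Precedes x) π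
  π-sorted = AllPairs-map-with proj₂ ⊏⇒Precedes (All.tabulate column-shape)
               (sortCols-strictly-sorted columns (zip-unique₂ x (ids n) (ids-unique n)))
    where
    ⊏⇒Precedes : ∀ {c d} → Shape c → Shape d → c ⊏ d → Precedes x (proj₂ c) (proj₂ d)
    ⊏⇒Precedes (_ , _ , refl) (_ , _ , refl) (inj₁ lt , _)          = inj₁ lt
    ⊏⇒Precedes (_ , _ , refl) (_ , _ , refl) (inj₂ (eq , v≤w) , c≢d) =
      inj₂ (eq , ≤∧≢⇒< v≤w (λ v≡w → c≢d (cong₂ _,_ eq (sym v≡w))))

  π-perm : PermOf n π
  π-perm = AllPairs.map (Precedes⇒≢ {x}) π-sorted , π⊆ , ⊆π
    where
    π⊆ : π ⊆ ids n
    π⊆ z∈ with ∈-map⁻ proj₂ z∈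
    ... | c , c∈ , refl = let 1≤w , w≤n , _ = column-shape c∈ in ∈-ids⁺ 1≤w w≤n
    ⊆π : ids n ⊆ π
    ⊆π {z} z∈ with ∈-ids⁻ z∈
    ... | 1≤z , z≤len = ∈-map⁺ proj₂ (∈-resp-↭ (↭-sym (sortCols-↭ columns))
                        (subst (λ w → (at x z , w) ∈ columns) (at-ids n z 1≤z z≤len)
                          (∈-zip⁺ x (ids n) z 1≤z z≤len (subst (z ≤_) (sym (length-ids n)) z≤len))))

module FromAvoider (x : List ℕ) (cayley : IsCayley x) (avoids : Avoids𝔞𝔠𝔡 x) where
  open Reading x
  open Sites π-perm

  Y : ℕ → ℕ
  Y s = at x (at π s)

  private
    ≤len : ∀ {p} → p ≤ n → p ≤ length π
    ≤len = subst (_ ≤_) (sym length-π)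

  avoids-shaded-descent : ¬ ContainsShadedDescent x
  avoids-shaded-descent =
    [ proj₁ (proj₂ avoids) , proj₂ (proj₂ avoids) ] ∘ Equivalence.to (shadedDescent⇔𝔠⊎𝔡 x)

  precedes : ∀ s t → 1 ≤ s → s < t → t ≤ n → Precedes x (at π s) (at π t)
  precedes s t 1≤s s<t t≤n = AllPairs-at π s t π-sorted 1≤s s<t (≤len t≤n)

  Y-mono : ∀ s t → 1 ≤ s → s ≤ t → t ≤ n → Y s ≤ Y t
  Y-mono s t 1≤s s≤t t≤n with m≤n⇒m<n∨m≡n s≤t
  ... | inj₂ refl = ≤-refl
  ... | inj₁ s<t with precedes s t 1≤s s<t t≤n
  ...   | inj₁ lt       = <⇒≤ lt
  ...   | inj₂ (eq , _) = ≤-reflexive eq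

  Y-positive : ∀ s → 1 ≤ s → s ≤ n → 1 ≤ Y s
  Y-positive s 1≤s s≤n = let 1≤πs , πs≤n = π-range s 1≤s s≤n in All-at x (at π s) (proj₁ cayley) 1≤πs πs≤n

  Y-≤-max : ∀ s → 1 ≤ s → s ≤ n → Y s ≤ maxW x
  Y-≤-max s 1≤s s≤n = let 1≤πs , πs≤n = π-range s 1≤s s≤n in ∈⇒≤maxW (at-∈ x (at π s) 1≤πs πs≤n)

  attained : ∀ b → 1 ≤ b → b ≤ maxW x → ∃ λ k → 1 ≤ k × k ≤ n × at x k ≡ b
  attained b 1≤b b≤max = ∈⇒at (proj₂ cayley b 1≤b b≤max)

  Y-inv : ∀ k → 1 ≤ k → k ≤ n → Y (inv k) ≡ at x k
  Y-inv k 1≤k k≤n = cong (at x) (π-inv k 1≤k k≤n)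

  Y-≤-value : ∀ s k → 1 ≤ s → 1 ≤ k → k ≤ n → s ≤ inv k → Y s ≤ at x k
  Y-≤-value s k 1≤s 1≤k k≤n s≤ =
    subst (Y s ≤_) (Y-inv k 1≤k k≤n) (Y-mono s (inv k) 1≤s s≤ (proj₂ (inv-range k 1≤k k≤n)))

  value-≤-Y : ∀ s k → 1 ≤ k → k ≤ n → inv k ≤ s → s ≤ n → at x k ≤ Y s
  value-≤-Y s k 1≤k k≤n ≤s s≤n =
    subst (_≤ Y s) (Y-inv k 1≤k k≤n) (Y-mono (inv k) s (proj₁ (inv-range k 1≤k k≤n)) ≤s s≤n)

  rise⇒leftmost : ∀ s → 1 ≤ s → s < n → Y s < Y (suc s) →
                  ∀ p → 1 ≤ p → p ≤ n → at x p ≡ Y s → at π s ≤ p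
  rise⇒leftmost s 1≤s s<n rise p 1≤p p≤n xp≡ with <-cmp (inv p) s
  ... | tri≈ _ refl _ = ≤-reflexive (π-inv p 1≤p p≤n)
  ... | tri> _ _ s<ip =
    ⊥-elim (<⇒≱ rise (subst (Y (suc s) ≤_) xp≡ (Y-≤-value (suc s) p z<s 1≤p p≤n s<ip)))
  ... | tri< ip<s _ _ with precedes (inv p) s (proj₁ (inv-range p 1≤p p≤n)) ip<s (<⇒≤ s<n)
  ...   | inj₁ lt       = ⊥-elim (<-irrefl (≡-trans (Y-inv p 1≤p p≤n) xp≡) lt)
  ...   | inj₂ (_ , lt) = <⇒≤ (subst (at π s <_) (π-inv p 1≤p p≤n) lt)

  rise⇒rightmost : ∀ s → 1 ≤ s → s < n → Y s < Y (suc s) →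
                   ∀ p → 1 ≤ p → p ≤ n → at x p ≡ Y (suc s) → p ≤ at π (suc s)
  rise⇒rightmost s 1≤s s<n rise p 1≤p p≤n xp≡ with <-cmp (inv p) (suc s)
  ... | tri≈ _ ip≡ _ = ≤-reflexive (≡-trans (sym (π-inv p 1≤p p≤n)) (cong (at π) ip≡))
  ... | tri< (s≤s ip≤s) _ _ =
    ⊥-elim (<⇒≱ rise (subst (_≤ Y s) xp≡ (value-≤-Y s p 1≤p p≤n ip≤s (<⇒≤ s<n))))
  ... | tri> _ _ s<ip with precedes (suc s) (inv p) z<s s<ip (proj₂ (inv-range p 1≤p p≤n))
  ...   | inj₁ lt       = ⊥-elim (<-irrefl (sym (≡-trans (Y-inv p 1≤p p≤n) xp≡)) lt)
  ...   | inj₂ (_ , lt) = <⇒≤ (subst (_< at π (suc s)) (π-inv p 1≤p p≤n) lt)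

  -- Y takes every value up to max x, so it cannot skip one.
  Y-rises-by-one : ∀ s → 1 ≤ s → s < n → Y s < Y (suc s) → Y (suc s) ≡ suc (Y s)
  Y-rises-by-one s 1≤s s<n rise with attained (suc (Y s)) z<s (≤-trans rise (Y-≤-max (suc s) z<s s<n))
  ... | k , 1≤k , k≤n , xk≡ with inv k ≤? s
  ...   | yes ik≤s = ⊥-elim (1+n≰n (subst (_≤ Y s) xk≡ (value-≤-Y s k 1≤k k≤n ik≤s (<⇒≤ s<n))))
  ...   | no  ik≰s =
    ≤-antisym (subst (Y (suc s) ≤_) xk≡ (Y-≤-value (suc s) k z<s 1≤k k≤n (≰⇒> ik≰s))) rise

  Y-one : 1 ≤ n → Y 1 ≡ 1
  Y-one 1≤n with attained 1 ≤-refl (≤-trans (Y-positive 1 ≤-refl 1≤n) (Y-≤-max 1 ≤-refl 1≤n))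
  ... | k , 1≤k , k≤n , xk≡ =
    ≤-antisym (subst (Y 1 ≤_) xk≡ (Y-≤-value 1 k ≤-refl 1≤k k≤n (proj₁ (inv-range k 1≤k k≤n))))
              (Y-positive 1 ≤-refl 1≤n)

  -- An active flat site would put the predecessor of π s before s, and the three values form an 𝔞.
  Y-flat⇒inactive : ∀ s → 1 ≤ s → s < n → Y s ≡ Y (suc s) → ¬ T (active π s)
  Y-flat⇒inactive s 1≤s s<n flat = no-reason ∘ Equivalence.to (active⇔reason s 1≤s s<n)
    where
    d = at π (suc s)
    1≤d = proj₁ (π-range (suc s) z<s s<n)
    d<v : d < at π s
    d<v with precedes s (suc s) 1≤s (n<1+n s) s<n
    ... | inj₁ lt       = ⊥-elim (<-irrefl flat lt)
    ... | inj₂ (_ , lt) = lt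
    no-predecessor-before : ∀ a → at π s ≡ suc a → ¬ inv a < s
    no-predecessor-before a v≡ inv<s =
      by-order (precedes (inv a) s (proj₁ (inv-range a 1≤a (<⇒≤ a<n))) inv<s (<⇒≤ s<n))
      where
      d≤a = s≤s⁻¹ (subst (d <_) v≡ d<v)
      1≤a = ≤-trans 1≤d d≤a
      a<n = subst (_≤ n) v≡ (proj₂ (π-range s 1≤s (<⇒≤ s<n)))
      by-order : Precedes x (at π (inv a)) (at π s) → ⊥
      by-order (inj₂ (_ , lt)) = 1+n≰n (<⇒≤ (subst₂ _<_ v≡ (π-inv a 1≤a (<⇒≤ a<n)) lt))
      by-order (inj₁ lt)       = proj₁ avoids (d , a , 1≤d , d<a , a<n , xa<xd , xd≡)
        where
        xa<xd : at x a < at x d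
        xa<xd = subst₂ _<_ (Y-inv a 1≤a (<⇒≤ a<n)) flat lt
        xd≡ : at x d ≡ at x (suc a)
        xd≡ = ≡-trans (sym flat) (cong (at x) v≡)
        d<a : d < a
        d<a = ≤∧≢⇒< d≤a (λ d≡a → <-irrefl (cong (at x) (sym d≡a)) xa<xd)
    no-reason : ¬ ActiveReason s
    no-reason (inj₁ v≡1)         = <-irrefl refl (<-≤-trans (subst (d <_) v≡1 d<v) 1≤d)
    no-reason (inj₂ (inj₁ inv<)) =
      no-predecessor-before (at π s ∸ 1) (sym (suc-∸1 (<-≤-trans 1≤d (<⇒≤ d<v)))) inv<
    no-reason (inj₂ (inj₂ v<d))  = <-asym v<d d<v

  -- The shadings hold because π s = a + 1 is the leftmost occurrence of Y s in x and d the
  -- rightmost occurrence of Y s + 1.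
  late-predecessor⇒shaded-descent : ∀ s a → 1 ≤ s → s < n → Y (suc s) ≡ suc (Y s) → at π s ≡ suc a →
    at π (suc s) < suc a → s < inv a → 1 ≤ a → ShadedDescent x (at π (suc s)) a
  late-predecessor⇒shaded-descent s a 1≤s s<n rise≡ v≡ d<sa s<ia 1≤a =
    1≤d , a<n , xsa<xd , d≤a-cases , left , right
    where
    d = at π (suc s)
    1≤d = proj₁ (π-range (suc s) z<s s<n)
    d≤a = s≤s⁻¹ d<sa
    a<n = subst (_≤ n) v≡ (proj₂ (π-range s 1≤s (<⇒≤ s<n)))
    rise : Y s < Y (suc s)
    rise = subst (Y s <_) (sym rise≡) (n<1+n (Y s))
    xsa≡ : at x (suc a) ≡ Y s
    xsa≡ = cong (at x) (sym v≡)
    xsa<xd : at x (suc a) < at x d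
    xsa<xd = subst (_< at x d) (sym xsa≡) rise
    d≤a-cases : d ≡ a ⊎ d < a × at x d < at x a
    d≤a-cases with m≤n⇒m<n∨m≡n d≤a
    ... | inj₂ d≡a = inj₁ d≡a
    ... | inj₁ d<a = inj₂ (d<a , ≤∧≢⇒< (Y-≤-value (suc s) a z<s 1≤a (<⇒≤ a<n) s<ia) xd≢xa)
      where
      xd≢xa : at x d ≢ at x a
      xd≢xa xd≡xa = <⇒≱ d<a (rise⇒rightmost s 1≤s s<n rise a 1≤a (<⇒≤ a<n) (sym xd≡xa))
    left : ∀ p → 1 ≤ p → p < a → p ≢ d → ¬ (at x (suc a) ≤ at x p × at x p < at x d)
    left p 1≤p p<a _ (lo , hi) =
      <⇒≱ p<a (≤-trans (n≤1+n a) (subst (_≤ p) v≡ (rise⇒leftmost s 1≤s s<n rise p 1≤p p≤n xp≡)))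
      where
      p≤n = ≤-trans (<⇒≤ p<a) (<⇒≤ a<n)
      xp≡ : at x p ≡ Y s
      xp≡ = ≤-antisym (s≤s⁻¹ (subst (at x p <_) rise≡ hi)) (subst (_≤ at x p) xsa≡ lo)
    right : ∀ p → suc a < p → p ≤ length x → ¬ (at x (suc a) < at x p × at x p ≤ at x d)
    right p sa<p p≤n (lo , hi) =
      <⇒≱ (<-trans (s≤s d≤a) sa<p) (rise⇒rightmost s 1≤s s<n rise p (<-trans z<s sa<p) p≤n xp≡)
      where
      xp≡ : at x p ≡ Y (suc s)
      xp≡ = ≤-antisym hi (subst (_≤ at x p) (sym rise≡) (subst (_< at x p) xsa≡ lo))

  -- The only rise without a reason, a descent with π s − 1 after s, would give 𝔠 or 𝔡.
  Y-rise⇒active : ∀ s → 1 ≤ s → s < n → Y (suc s) ≡ suc (Y s) → T (active π s)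
  Y-rise⇒active s 1≤s s<n rise≡ = Equivalence.from (active⇔reason s 1≤s s<n) reason
    where
    d = at π (suc s)
    1≤v = proj₁ (π-range s 1≤s (<⇒≤ s<n))
    reason-below : ∀ a → at π s ≡ suc a → d < suc a → ActiveReason s
    reason-below zero      v≡ _    = inj₁ v≡
    reason-below a@(suc _) v≡ d<sa with <-cmp (inv a) s
    ... | tri< ia<s _ _ = inj₂ (inj₁ (subst (λ u → inv (u ∸ 1) < s) (sym v≡) ia<s))
    ... | tri≈ _ ia≡s _ =
      ⊥-elim (1+n≢n (≡-trans (sym v≡) (≡-trans (cong (at π) (sym ia≡s)) (π-inv a z<s a≤n))))
      where a≤n = <⇒≤ (subst (_≤ n) v≡ (proj₂ (π-range s 1≤s (<⇒≤ s<n))))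
    ... | tri> _ _ s<ia = ⊥-elim (avoids-shaded-descent (d , a ,
                            late-predecessor⇒shaded-descent s a 1≤s s<n rise≡ v≡ d<sa s<ia z<s))
    reason : ActiveReason s
    reason with <-cmp (at π s) d
    ... | tri< v<d _ _ = inj₂ (inj₂ v<d)
    ... | tri≈ _ v≡d _ = ⊥-elim (1+n≢n (π-injective (suc s) s z<s s<n 1≤s (<⇒≤ s<n) (sym v≡d)))
    ... | tri> _ _ d<v = reason-below (at π s ∸ 1) (sym (suc-∸1 1≤v)) (subst (d <_) (sym (suc-∸1 1≤v)) d<v)

  A≡Y-step : ∀ s → 1 ≤ s → s < n → A s ≡ Y s → A (suc s) ≡ Y (suc s)
  A≡Y-step s 1≤s s<n As≡Ys with m≤n⇒m<n∨m≡n (Y-mono s (suc s) 1≤s (n≤1+n s) s<n)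
  ... | inj₁ rise = begin
    A (suc s)         ≡⟨ active⇒rise s (Y-rise⇒active s 1≤s s<n rise≡) ⟩
    suc (A s)         ≡⟨ cong suc As≡Ys ⟩
    suc (Y s)         ≡⟨ rise≡ ⟨
    Y (suc s)         ∎
    where
    open ≡-Reasoning
    rise≡ = Y-rises-by-one s 1≤s s<n rise
  ... | inj₂ flat = begin
    A (suc s)         ≡⟨ inactive⇒flat s (Y-flat⇒inactive s 1≤s s<n flat) ⟩
    A s               ≡⟨ As≡Ys ⟩
    Y s               ≡⟨ flat ⟩
    Y (suc s)         ∎
    where open ≡-Reasoning

  A≡Y : ∀ s → 1 ≤ s → s ≤ n → A s ≡ Y s
  A≡Y (suc zero)    _ 1≤n = ≡-trans A-one (sym (Y-one 1≤n))
  A≡Y (suc (suc s)) _ s<n = A≡Y-step (suc s) z<s s<n (A≡Y (suc s) z<s (<⇒≤ s<n))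

  η-reading : η π ≡ x
  η-reading = at-extensionality (η π) x η-length λ k 1≤k k≤ →
    let k≤n = subst (k ≤_) η-length k≤ in begin
    at (η π) k    ≡⟨ η-at k 1≤k k≤n ⟩
    A (inv k)     ≡⟨ A≡Y (inv k) (proj₁ (inv-range k 1≤k k≤n)) (proj₂ (inv-range k 1≤k k≤n)) ⟩
    Y (inv k)     ≡⟨ Y-inv k 1≤k k≤n ⟩
    at x k        ∎
    where open ≡-Reasoning

  inX : InX x
  inX = π , PermOf⇒IsPerm π-perm , η-reading

-- Enumeration

concatMap-unique : ∀ {A B : Set} (g : A → List B) xs → Unique xs → (∀ a → Unique (g a)) →
                   (∀ {a b z} → z ∈ g a → z ∈ g b → a ≡ b) → Unique (concatMap g xs)
concatMap-unique g []       _        _      _        = []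
concatMap-unique g (a ∷ as) (a∉ ∷ u) unique disjoint =
  Uniqueₚ.++⁺ (unique a) (concatMap-unique g as u unique disjoint) λ (z∈ga , z∈rest) →
    let b , b∈ , z∈gb = find (∈-concatMap⁻ g {xs = as} z∈rest) in All.lookup a∉ b∈ (disjoint z∈ga z∈gb)

length-concatMap : ∀ {A B : Set} (g : A → List B) xs L → (∀ {a} → a ∈ xs → length (g a) ≡ L) →
                   length (concatMap g xs) ≡ length xs * L
length-concatMap g []       L _   = refl
length-concatMap g (a ∷ as) L len =
  ≡-trans (length-++ (g a)) (cong₂ _+_ (len (here refl)) (length-concatMap g as L (len ∘ there)))

-- The first argument is fuel; with at least length S of it every arrangement of S is listed.
arrangements : ℕ → List ℕ → List (List ℕ)
arrangements _       []           = [] ∷ []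
arrangements zero    (_ ∷ _)      = []
arrangements (suc f) S@(_ ∷ _)    = concatMap (λ a → map (a ∷_) (arrangements f (delete a S))) S

∈-arrangements⁻ : ∀ f S π → Unique S → π ∈ arrangements f S → Unique π × π ⊆ S × S ⊆ π
∈-arrangements⁻ f []                π uS (here refl) = [] , (λ ()) , (λ ())
∈-arrangements⁻ (suc f) S@(_ ∷ _) π uS π∈
  with find (∈-concatMap⁻ (λ a → map (a ∷_) (arrangements f (delete a S))) {xs = S} π∈)
... | a , a∈S , π∈a∷ with ∈-map⁻ (a ∷_) π∈a∷
... | π′ , π′∈ , refl with ∈-arrangements⁻ f (delete a S) π′ (delete-unique a S uS) π′∈
... | uπ′ , π′⊆ , ⊆π′ = All.tabulate (λ z∈ → ∈-delete-≢ a S uS (π′⊆ z∈) ∘ sym) ∷ uπ′ , π⊆ , ⊆π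
  where
  π⊆ : (a ∷ π′) ⊆ S
  π⊆ (here refl) = a∈S
  π⊆ (there z∈)  = ∈-delete⁻ a S (π′⊆ z∈)
  ⊆π : S ⊆ (a ∷ π′)
  ⊆π {z} z∈ with z ≟ a
  ... | yes refl = here refl
  ... | no  z≢a  = there (⊆π′ (∈-delete⁺ a S z∈ z≢a))

∈-arrangements⁺ : ∀ f S π → Unique S → length S ≤ f →
                  Unique π → π ⊆ S → S ⊆ π → π ∈ arrangements f S
∈-arrangements⁺ f []      []      _ _ _ _ _ = here refl
∈-arrangements⁺ f []      (z ∷ π) _ _ _ π⊆ _ with π⊆ (here refl)
... | ()
∈-arrangements⁺ (suc f) S@(s ∷ _) [] _ _ _ _ ⊆π with ⊆π (here {x = s} refl)
... | ()
∈-arrangements⁺ (suc f) S@(_ ∷ _) (a ∷ π′) uS (s≤s len≤) (a∉ ∷ uπ′) π⊆ ⊆π =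
  ∈-concatMap⁺ (λ b → map (b ∷_) (arrangements f (delete b S)))
    (lose a∈S (∈-map⁺ (a ∷_)
      (∈-arrangements⁺ f (delete a S) π′ (delete-unique a S uS) len≤del uπ′ π′⊆ ⊆π′)))
  where
  a∈S = π⊆ (here refl)
  len≤del : length (delete a S) ≤ f
  len≤del = subst (_≤ f) (suc-injective (length-delete a S a∈S)) len≤
  π′⊆ : π′ ⊆ delete a S
  π′⊆ z∈ = ∈-delete⁺ a S (π⊆ (there z∈)) (λ z≡a → All.lookup a∉ z∈ (sym z≡a))
  ⊆π′ : delete a S ⊆ π′
  ⊆π′ z∈ with ⊆π (∈-delete⁻ a S z∈)
  ... | here z≡a   = ⊥-elim (∈-delete-≢ a S uS z∈ z≡a)
  ... | there z∈π′ = z∈π′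

arrangements-unique : ∀ f S → Unique S → Unique (arrangements f S)
arrangements-unique f       []        _  = [] ∷ []
arrangements-unique zero    (_ ∷ _)   _  = []
arrangements-unique (suc f) S@(_ ∷ _) uS = concatMap-unique prefixed S uS unique disjoint
  where
  prefixed : ℕ → List (List ℕ)
  prefixed a = map (a ∷_) (arrangements f (delete a S))
  unique : ∀ a → Unique (prefixed a)
  unique a = Uniqueₚ.map⁺ ∷-injectiveʳ (arrangements-unique f (delete a S) (delete-unique a S uS))
  disjoint : ∀ {a b z} → z ∈ prefixed a → z ∈ prefixed b → a ≡ b
  disjoint z∈a z∈b with ∈-map⁻ (_ ∷_) z∈a | ∈-map⁻ (_ ∷_) z∈b
  ... | _ , _ , refl | _ , _ , refl = refl

length-arrangements : ∀ f S → Unique S → length S ≤ f → length (arrangements f S) ≡ length S !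
length-arrangements f       []             _  _           = refl
length-arrangements (suc f) S@(_ ∷ rest) uS (s≤s len≤) =
  length-concatMap (λ a → map (a ∷_) (arrangements f (delete a S))) S (length rest !) count
  where
  count : ∀ {a} → a ∈ S → length (map (a ∷_) (arrangements f (delete a S))) ≡ length rest !
  count {a} a∈S = begin
    length (map (a ∷_) (arrangements f (delete a S)))  ≡⟨ length-map (a ∷_) (arrangements f (delete a S)) ⟩
    length (arrangements f (delete a S))               ≡⟨ length-arrangements f (delete a S) (delete-unique a S uS)
                                                            (subst (_≤ f) (sym len-del) len≤) ⟩
    length (delete a S) !                               ≡⟨ cong _! len-del ⟩
    length rest !                                       ∎
    where
    open ≡-Reasoning
    len-del : length (delete a S) ≡ length rest
    len-del = sym (suc-injective (length-delete a S a∈S))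

∈-permutations⇔ : ∀ n {π} → π ∈ arrangements n (ids n) ⇔ PermOf n π
∈-permutations⇔ n {π} = mk⇔ (∈-arrangements⁻ n (ids n) π (ids-unique n))
  λ (u , π⊆ , ⊆π) → ∈-arrangements⁺ n (ids n) π (ids-unique n) (≤-reflexive (length-ids n)) u π⊆ ⊆π

X⇔Cayley-avoider : ∀ x → InX x ⇔ (IsCayley x × Avoids𝔞𝔠𝔡 x)
X⇔Cayley-avoider x =
  mk⇔ (λ { (π , isPerm , refl) → EtaOfPermutation.η-Cayley-avoider (IsPerm⇒PermOf π isPerm) })
      (λ (cayley , avoids) → FromAvoider.inX x cayley avoids)

∈-η-permutations⇔ : ∀ n x →
  x ∈ map η (arrangements n (ids n)) ⇔ (IsCayley x × length x ≡ n × Avoids𝔞𝔠𝔡 x)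
∈-η-permutations⇔ n x = mk⇔ from-permutation to-permutation
  where
  from-permutation : x ∈ map η (arrangements n (ids n)) → IsCayley x × length x ≡ n × Avoids𝔞𝔠𝔡 x
  from-permutation x∈ with ∈-map⁻ η x∈
  ... | π , π∈ , refl = let P = Equivalence.to (∈-permutations⇔ n) π∈
                            cayley , avoids = EtaOfPermutation.η-Cayley-avoider P
                        in cayley , Sites.η-length P , avoids
  to-permutation : IsCayley x × length x ≡ n × Avoids𝔞𝔠𝔡 x → x ∈ map η (arrangements n (ids n))
  to-permutation (cayley , refl , avoids) =
    subst (_∈ map η (arrangements n (ids n))) (FromAvoider.η-reading x cayley avoids)
      (∈-map⁺ η (Equivalence.from (∈-permutations⇔ n) (Reading.π-perm x)))

η-permutations-unique : ∀ n → Unique (map η (arrangements n (ids n)))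
η-permutations-unique n =
  map-unique-on η (arrangements n (ids n)) (λ π∈ π′∈ → η-injective (perm π∈) (perm π′∈))
    (arrangements-unique n (ids n) (ids-unique n))
  where
  perm : ∀ {π} → π ∈ arrangements n (ids n) → PermOf n π
  perm = Equivalence.to (∈-permutations⇔ n)

length-η-permutations : ∀ n → length (map η (arrangements n (ids n))) ≡ n !
length-η-permutations n = begin
  length (map η (arrangements n (ids n)))  ≡⟨ length-map η (arrangements n (ids n)) ⟩
  length (arrangements n (ids n))          ≡⟨ length-arrangements n (ids n) (ids-unique n)
                                                                   (≤-reflexive (length-ids n)) ⟩
  length (ids n) !                         ≡⟨ cong _! (length-ids n) ⟩
  n !                                      ∎
  where open ≡-Reasoning

mainTheorem7 :
    (∀ (x : List ℕ) → InX x ⇔ (IsCayley x × Avoids𝔞𝔠𝔡 x)) ×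
    (∀ (n : ℕ) → ∃ λ (l : List (List ℕ)) →
        Unique l ×
        (∀ x → (x ∈ l) ⇔ (IsCayley x × length x ≡ n × Avoids𝔞𝔠𝔡 x)) ×
        length l ≡ n !)
mainTheorem7 =
  X⇔Cayley-avoider ,
  λ n → map η (arrangements n (ids n)) ,
        η-permutations-unique n , ∈-η-permutations⇔ n , length-η-permutations n
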